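{- If $G$ is a connected bipartite permutation graph, then $\chi_{ssc}(G)\le 4$.
   Context: Graphs are finite, simple and undirected. For a vertex $v$, $N(v)$ is its open neighbourhood, $N[v]=N(v)\cup\{v\}$ and $\deg(v)=|N(v)|$. For a positive integer $q$, a $q$-subset square colouring of a graph $G$ is a function $c:V(G)\to\{c_0,c_1,\dots,c_q\}$ such that (i) for every vertex $v$ and every $i\in\{1,\dots,q\}$, $|c^{ -1}(c_i)\cap N[v]|\le 1$, and (ii) for every vertex $v$, $N[v]$ contains at most $\deg(v)$ vertices of colour $c_0$ (equivalently, $N[v]$ contains at least one vertex whose colour lies in $\{c_1,\dots,c_q\}$). $\chi_{ssc}(G)$ is the minimum $q$ such that $G$ admits a $q$-subset square colouring. A permutation graph is a graph whose vertices can be identified with $\{1,\dots,n\}$ so that, for some permutation $\pi$ of $\{1,\dots,n\}$, $i<j$ are adjacent iff $\pi(i)>\pi(j)$. A bipartite permutation graph is a graph that is both bipartite and a permutation graph. -}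

module Defs where

open import Data.Nat using (ℕ; zero; suc; _≤_; _<_)
open import Data.Fin as Fin using (Fin)
open import Data.Fin.Properties using (_≟_)
open import Data.Bool using (Bool; true; false; _∨_; _∧_; not; T)
open import Data.List using (List; length; filter; []; _∷_)
open import Data.List.Base using ()
open import Data.Product using (Σ; _×_; ∃; ∃-syntax; _,_)
open import Data.Sum using (_⊎_)
open import Relation.Nullary using (¬_)
open import Relation.Nullary.Decidable using (⌊_⌋)
open import Relation.Binary.PropositionalEquality using (_≡_)
open import Function.Bundles using (_↔_; Inverse)

vertices : (n : ℕ) → List (Fin n)
vertices n = Data.List.allFin n

count : {n : ℕ} → (Fin n → Bool) → ℕ
count {n} P = length (filter (λ x → T? (P x)) (vertices n))
  where
  open import Data.Bool.Properties using (T?)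

record Graph (n : ℕ) : Set where
  field
    adj     : Fin n → Fin n → Bool
    symm    : ∀ u v → adj u v ≡ adj v u
    irrefl  : ∀ v → adj v v ≡ false
open Graph public

deg : {n : ℕ} → Graph n → Fin n → ℕ
deg G v = count (λ w → adj G v w)

inN[_] : {n : ℕ} → Graph n → Fin n → Fin n → Bool
inN[ G ] v w = ⌊ w ≟ v ⌋ ∨ adj G v w

data Walk {n : ℕ} (G : Graph n) : Fin n → Fin n → Set where
  here : ∀ {v} → Walk G v v
  step : ∀ {u v w} → T (adj G u v) → Walk G v w → Walk G u w

Connected : {n : ℕ} → Graph n → Set
Connected G = ∀ u v → Walk G u v

Bipartite : {n : ℕ} → Graph n → Set
Bipartite {n} G = Σ (Fin n → Bool) λ f → ∀ u v → T (adj G u v) → ¬ (f u ≡ f v)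

-- permutation graph: vertices identified with positions {0..n-1} via a
-- bijection σ, and a permutation π of those positions, such that for
-- positions i < j, the vertices are adjacent iff π i > π j.
IsPermutationGraph : {n : ℕ} → Graph n → Set
IsPermutationGraph {n} G =
  Σ (Fin n ↔ Fin n) λ σ → Σ (Fin n ↔ Fin n) λ π →
    ∀ u v → Fin.toℕ (Inverse.to σ u) < Fin.toℕ (Inverse.to σ v) →
      (T (adj G u v) → Fin.toℕ (Inverse.to π (Inverse.to σ v)) < Fin.toℕ (Inverse.to π (Inverse.to σ u)))
      × (Fin.toℕ (Inverse.to π (Inverse.to σ v)) < Fin.toℕ (Inverse.to π (Inverse.to σ u)) → T (adj G u v))

BipartitePermutationGraph : {n : ℕ} → Graph n → Set
BipartitePermutationGraph G = Bipartite G × IsPermutationGraph G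

-- q-subset square colouring: colours are Fin (suc q), colour `zero` is c₀,
-- colour `suc i` is c_{i+1}.
IsSubsetSquareColouring : {n : ℕ} → Graph n → (q : ℕ) → (Fin n → Fin (suc q)) → Set
IsSubsetSquareColouring G q c =
  (∀ v (i : Fin q) → count (λ w → inN[ G ] v w ∧ ⌊ c w ≟ Fin.suc i ⌋) ≤ 1)
  × (∀ v → count (λ w → inN[ G ] v w ∧ ⌊ c w ≟ Fin.zero ⌋) ≤ deg G v)

HasSubsetSquareColouring : {n : ℕ} → Graph n → ℕ → Set
HasSubsetSquareColouring {n} G q = Σ (Fin n → Fin (suc q)) λ c → IsSubsetSquareColouring G q c

χssc≤ : {n : ℕ} → Graph n → ℕ → Set
χssc≤ G k = ∃[ q ] (1 ≤ q × q ≤ k × HasSubsetSquareColouring G q)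

{-# OPTIONS --safe #-}
-- Draw G as a permutation diagram: vertex x is a segment from position top x on one line to position
-- bottom x on a parallel line, and two vertices are adjacent iff their segments cross.  Sweep the
-- diagram from the segment with top end 0: stage k covers the segments whose top end is left of A k or
-- whose bottom end is left of C k, and each stage pushes each boundary to the farthest point reached by
-- the segments covered on the other side.  The boundaries move alternately, so every segment first
-- covered at stage k + 1 crosses or equals the one covered segment reaching farthest across the
-- boundary that moved; call it the centre of stage k.  The level of a vertex is the first stage
-- covering it.  Colour the centre of stage k with c_{1 + (k mod 3)} and everything else with c₀.
-- Adjacent vertices have levels differing by at most one, so a closed neighbourhood spans at most
-- three levels and meets each colour at most once; and it always contains a centre.
module Submission where

open import Data.Bool using (Bool; true; false; T; _∧_)
open import Data.Bool.Properties using (T?; T-∧; T-∨)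
open import Data.Empty using (⊥-elim)
open import Data.Fin using (Fin; zero; suc; toℕ)
open import Data.Fin.Properties using (_≟_; suc-injective; 0≢1+n; toℕ-injective; toℕ-fromℕ<)
open import Data.List using (length; filter; tabulate)
open import Data.Nat using (ℕ; zero; suc; _+_; _*_; _∸_; _⊔_; _≤_; _<_; _≤′_; ≤′-refl; ≤′-step; z≤n; s≤s; NonZero; _<?_)
open import Data.Nat.DivMod using (_%_; _/_; _mod_; m≡m%n+[m/n]*n)
open import Data.Nat.Properties
  using ( ≤-refl; ≤-trans; ≤-antisym; ≤-total; ≤-pred; <-trans; <-≤-trans; <⇒≤; <⇒≱; ≮⇒≥; <-cmp; <-asym
        ; n≤1+n; m≤n⇒m≤1+n; m<n⇒m<1+n; m<1+n⇒m<n∨m≡n; m≤n⇒m<n∨m≡n; n<1⇒n≡0; n≮0; n≤0⇒n≡0; ≤⇒≤′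
        ; +-identityʳ; +-suc; m≤m+n; m+n∸n≡m; ∸-monoˡ-<; m∸n≡0⇒m≤n; [m+n]∸[m+o]≡n∸o; *-distribʳ-∸
        ; ⊔-sel; m≤m⊔n; m≤n⊔m; m≥n⇒m⊔n≡m
        ; module ≤-Reasoning )
import Data.Nat.Properties as ℕ
open import Data.Product using (∃-syntax; _×_; _,_; proj₁; proj₂)
open import Data.Sum using (_⊎_; inj₁; inj₂; [_,_]′) renaming (map to ⊎-map)
open import Data.Unit using (tt)
open import Function using (_∘_; id)
open import Function.Bundles using (Inverse; Injection; _⇔_; mk⇔; Equivalence)
open import Function.Properties.Inverse using (↔⇒↣)
open import Relation.Binary using (tri<; tri≈; tri>)
open import Relation.Binary.PropositionalEquality using (_≡_; _≢_; refl; sym; trans; cong; cong₂; subst; module ≡-Reasoning)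
open import Relation.Nullary using (¬_; Dec; yes; no)
open import Relation.Nullary.Decidable using (⌊_⌋; toWitness; fromWitness; map′; _×-dec_; _⊎-dec_)
open import Relation.Unary using (Decidable)

open import Defs

private
  variable
    n : ℕ

-- Counting

length-filter-tabulate : ∀ {A : Set} {n} (P : A → Bool) (f : Fin n → A) →
                         length (filter (T? ∘ P) (tabulate f)) ≡ count (P ∘ f)
length-filter-tabulate {n = zero}  P f = refl
length-filter-tabulate {n = suc n} P f with P (f zero)
... | true  = cong suc tail
  where tail = trans (length-filter-tabulate P (f ∘ suc)) (sym (length-filter-tabulate (P ∘ f) suc))
... | false = trans (length-filter-tabulate P (f ∘ suc)) (sym (length-filter-tabulate (P ∘ f) suc))

count-true : (P : Fin (suc n) → Bool) → T (P zero) → count P ≡ suc (count (P ∘ suc))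
count-true P p with P zero
... | true = cong suc (length-filter-tabulate P suc)

count-false : (P : Fin (suc n) → Bool) → ¬ T (P zero) → count P ≡ count (P ∘ suc)
count-false P ¬p with P zero
... | true  = ⊥-elim (¬p tt)
... | false = length-filter-tabulate P suc

count-tail≤count : (P : Fin (suc n) → Bool) → count (P ∘ suc) ≤ count P
count-tail≤count P with T? (P zero)
... | yes p  rewrite count-true P p   = n≤1+n _
... | no ¬p  rewrite count-false P ¬p = ≤-refl

count≤1+count-tail : (P : Fin (suc n) → Bool) → count P ≤ suc (count (P ∘ suc))
count≤1+count-tail P with T? (P zero)
... | yes p  rewrite count-true P p   = ≤-refl
... | no ¬p  rewrite count-false P ¬p = n≤1+n _

count-none : (P : Fin n → Bool) → (∀ x → ¬ T (P x)) → count P ≡ 0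
count-none {zero}  P none = refl
count-none {suc n} P none = trans (count-false P (none zero)) (count-none (P ∘ suc) (none ∘ suc))

count-mono : (P Q : Fin n → Bool) → (∀ x → T (P x) → T (Q x)) → count P ≤ count Q
count-mono {zero}  P Q P⇒Q = z≤n
count-mono {suc n} P Q P⇒Q with T? (P zero) | T? (Q zero) | count-mono (P ∘ suc) (Q ∘ suc) (P⇒Q ∘ suc)
... | yes p | yes q | ih rewrite count-true P p   | count-true Q q   = s≤s ih
... | yes p | no ¬q | _  = ⊥-elim (¬q (P⇒Q zero p))
... | no ¬p | yes q | ih rewrite count-false P ¬p | count-true Q q   = m≤n⇒m≤1+n ih
... | no ¬p | no ¬q | ih rewrite count-false P ¬p | count-false Q ¬q = ih

count-< : (P Q : Fin n → Bool) → (∀ x → T (P x) → T (Q x)) →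
          ∀ u → T (Q u) → ¬ T (P u) → count P < count Q
count-< {suc n} P Q P⇒Q zero q ¬p rewrite count-false P ¬p | count-true Q q =
  s≤s (count-mono (P ∘ suc) (Q ∘ suc) (P⇒Q ∘ suc))
count-< {suc n} P Q P⇒Q (suc u) qu ¬pu
  with T? (P zero) | T? (Q zero) | count-< (P ∘ suc) (Q ∘ suc) (P⇒Q ∘ suc) u qu ¬pu
... | yes p | yes q | ih rewrite count-true P p   | count-true Q q   = s≤s ih
... | yes p | no ¬q | _  = ⊥-elim (¬q (P⇒Q zero p))
... | no ¬p | yes q | ih rewrite count-false P ¬p | count-true Q q   = m<n⇒m<1+n ih
... | no ¬p | no ¬q | ih rewrite count-false P ¬p | count-false Q ¬q = ih

count-≤1 : (P : Fin n → Bool) → (∀ x y → T (P x) → T (P y) → x ≡ y) → count P ≤ 1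
count-≤1 {zero}  P unique = z≤n
count-≤1 {suc n} P unique with T? (P zero)
... | yes p rewrite count-true P p | count-none (P ∘ suc) (λ x → 0≢1+n ∘ unique zero (suc x) p) = ≤-refl
... | no ¬p rewrite count-false P ¬p =
  count-≤1 (P ∘ suc) (λ x y px py → suc-injective (unique (suc x) (suc y) px py))

count-insert : (P R : Fin n → Bool) (v : Fin n) → (∀ w → T (P w) → w ≡ v ⊎ T (R w)) →
               count P ≤ suc (count R)
count-insert {suc n} P R zero P⊆v∪R = begin
  count P                ≤⟨ count≤1+count-tail P ⟩
  suc (count (P ∘ suc))  ≤⟨ s≤s (count-mono (P ∘ suc) (R ∘ suc) P⊆R) ⟩
  suc (count (R ∘ suc))  ≤⟨ s≤s (count-tail≤count R) ⟩
  suc (count R)          ∎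
  where
  open ≤-Reasoning
  P⊆R : ∀ w → T (P (suc w)) → T (R (suc w))
  P⊆R w p with P⊆v∪R (suc w) p
  ... | inj₂ r = r
count-insert {suc n} P R (suc v) P⊆v∪R
  with T? (P zero) | count-insert (P ∘ suc) (R ∘ suc) v (λ w → ⊎-map suc-injective id ∘ P⊆v∪R (suc w))
... | yes p | ih with P⊆v∪R zero p
...   | inj₂ r rewrite count-true P p | count-true R r = s≤s ih
count-insert {suc n} P R (suc v) P⊆v∪R | no ¬p | ih rewrite count-false P ¬p =
  ≤-trans ih (s≤s (count-tail≤count R))

mod-injective-window : ∀ d .{{_ : NonZero d}} {m n} → m ≤ n → n < d + m → m mod d ≡ n mod d → m ≡ n
mod-injective-window d {m} {n} m≤n n<d+m eq = ≤-antisym m≤n (m∸n≡0⇒m≤n gap≡0)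
  where
  open ≡-Reasoning
  m%d≡n%d : m % d ≡ n % d
  m%d≡n%d = trans (sym (toℕ-fromℕ< _)) (trans (cong toℕ eq) (toℕ-fromℕ< _))
  gap≡ : n ∸ m ≡ (n / d ∸ m / d) * d
  gap≡ = begin
    n ∸ m                                      ≡⟨ cong₂ _∸_ (m≡m%n+[m/n]*n n d) (m≡m%n+[m/n]*n m d) ⟩
    (n % d + n / d * d) ∸ (m % d + m / d * d)  ≡⟨ cong (λ r → (r + n / d * d) ∸ (m % d + m / d * d)) (sym m%d≡n%d) ⟩
    (m % d + n / d * d) ∸ (m % d + m / d * d)  ≡⟨ [m+n]∸[m+o]≡n∸o (m % d) _ _ ⟩
    n / d * d ∸ m / d * d                      ≡⟨ sym (*-distribʳ-∸ d (n / d) (m / d)) ⟩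
    (n / d ∸ m / d) * d                        ∎
  gap<d : (n / d ∸ m / d) * d < d
  gap<d = subst (_< d) gap≡ (subst (n ∸ m <_) (m+n∸n≡m d m) (∸-monoˡ-< n<d+m m≤n))
  gap≡0 : n ∸ m ≡ 0
  gap≡0 with n / d ∸ m / d | gap≡ | gap<d
  ... | zero  | gap≡0*d | _     = gap≡0*d
  ... | suc q | _       | q*d<d = ⊥-elim (<⇒≱ q*d<d (m≤m+n d (q * d)))

m<n⊔o⇒m<n⊎m<o : ∀ {m} n o → m < n ⊔ o → m < n ⊎ m < o
m<n⊔o⇒m<n⊎m<o n o m<n⊔o with ⊔-sel n o
... | inj₁ n⊔o≡n = inj₁ (subst (_ <_) n⊔o≡n m<n⊔o)
... | inj₂ n⊔o≡o = inj₂ (subst (_ <_) n⊔o≡o m<n⊔o)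

monotone-by-steps : (f : ℕ → ℕ) → (∀ k → f k ≤ f (suc k)) → ∀ {j k} → j ≤ k → f j ≤ f k
monotone-by-steps f f-step j≤k = go (≤⇒≤′ j≤k)
  where
  go : ∀ {j k} → j ≤′ k → f j ≤ f k
  go ≤′-refl          = ≤-refl
  go (≤′-step j≤′k) = ≤-trans (go j≤′k) (f-step _)

Least : (ℕ → Set) → Set
Least P = ∃[ k ] P k × (∀ {j} → j < k → ¬ P j)

least-witness : {P : ℕ → Set} → Decidable P → ∀ {m} → P m → Least P
least-witness {P} P? {m} = search 0 m (λ ())
  where
  search : ∀ i fuel → (∀ {j} → j < i → ¬ P j) → P (i + fuel) → Least P
  search i zero       below p = i , subst P (+-identityʳ i) p , below
  search i (suc fuel) below p with P? i
  ... | yes pᵢ = i , pᵢ , below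
  ... | no ¬pᵢ = search (suc i) fuel below′ (subst P (+-suc i fuel) p)
    where
    below′ : ∀ {j} → j < suc i → ¬ P j
    below′ j<1+i with m<1+n⇒m<n∨m≡n j<1+i
    ... | inj₁ j<i  = below j<i
    ... | inj₂ refl = ¬pᵢ

-- The least strict upper bound of f on P; it is 0 when P is empty.
strictSup : {P : Fin n → Set} → Decidable P → (Fin n → ℕ) → ℕ
strictSup {zero}  P? f = 0
strictSup {suc n} P? f with P? zero
... | yes _ = suc (f zero) ⊔ strictSup (P? ∘ suc) (f ∘ suc)
... | no  _ = strictSup (P? ∘ suc) (f ∘ suc)

strictSup-bound : {P : Fin n → Set} (P? : Decidable P) (f : Fin n → ℕ) →
                  ∀ {x} → P x → f x < strictSup P? f
strictSup-bound {suc n} P? f {zero} px with P? zero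
... | yes _  = m≤m⊔n (suc (f zero)) (strictSup (P? ∘ suc) (f ∘ suc))
... | no ¬p  = ⊥-elim (¬p px)
strictSup-bound {suc n} P? f {suc x} px with P? zero
... | yes _  = ≤-trans (strictSup-bound (P? ∘ suc) (f ∘ suc) px) (m≤n⊔m _ _)
... | no _   = strictSup-bound (P? ∘ suc) (f ∘ suc) px

strictSup-attained : {P : Fin n → Set} (P? : Decidable P) (f : Fin n → ℕ) →
                     0 < strictSup P? f → ∃[ x ] P x × suc (f x) ≡ strictSup P? f
strictSup-attained {suc n} P? f pos with P? zero
... | no _ with strictSup-attained (P? ∘ suc) (f ∘ suc) pos
...   | x , px , fx = suc x , px , fx
strictSup-attained {suc n} P? f pos | yes p with ⊔-sel (suc (f zero)) (strictSup (P? ∘ suc) (f ∘ suc))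
... | inj₁ eq = zero , p , sym eq
... | inj₂ eq with strictSup-attained (P? ∘ suc) (f ∘ suc) (subst (0 <_) eq pos)
...   | x , px , fx = suc x , px , trans fx (sym eq)

-- Colouring from a layered dominating set

∈closedNbhd⇔ : ∀ {G : Graph n} {v w} → T (inN[ G ] v w) ⇔ (w ≡ v ⊎ T (adj G v w))
∈closedNbhd⇔ {v = v} {w} = mk⇔ (⊎-map toWitness id ∘ Equivalence.to (T-∨ {⌊ w ≟ v ⌋}))
                                (Equivalence.from T-∨ ∘ ⊎-map fromWitness id)

record LayeredDominatingSet (G : Graph n) : Set₁ where
  field
    level            : Fin n → ℕ
    Centre           : Fin n → Set
    centre?          : Decidable Centre
    level-lipschitz  : ∀ {x y} → T (adj G x y) → level y ≤ suc (level x)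
    centre-unique    : ∀ {x y} → Centre x → Centre y → level x ≡ level y → x ≡ y
    centre-dominates : ∀ v → ∃[ u ] Centre u × (u ≡ v ⊎ T (adj G v u))

module _ {G : Graph n} (L : LayeredDominatingSet G) where
  open LayeredDominatingSet L

  colour : Fin n → Fin 4
  colour x with centre? x
  ... | yes _ = suc (level x mod 3)
  ... | no  _ = zero

  colour≡suc⇒centre : ∀ {x i} → colour x ≡ suc i → Centre x × level x mod 3 ≡ i
  colour≡suc⇒centre {x} eq with centre? x
  ... | yes c = c , suc-injective eq

  centre⇒colour≢zero : ∀ {x} → Centre x → colour x ≢ zero
  centre⇒colour≢zero {x} c eq with centre? x
  ... | no ¬c = ¬c c

  level-in-closedNbhd : ∀ {v w} → T (inN[ G ] v w) → level w ≤ suc (level v) × level v ≤ suc (level w)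
  level-in-closedNbhd {v} {w} w∈N[v] with Equivalence.to (∈closedNbhd⇔ {G = G} {v} {w}) w∈N[v]
  ... | inj₁ refl = n≤1+n _ , n≤1+n _
  ... | inj₂ vw = level-lipschitz vw , level-lipschitz (subst T (symm G v w) vw)

  -- Two vertices of N[v] have levels within 2 of each other, so their levels mod 3 determine them.
  colour-unique-in-closedNbhd : ∀ {v x y i} → T (inN[ G ] v x) → T (inN[ G ] v y) →
                                colour x ≡ suc i → colour y ≡ suc i → x ≡ y
  colour-unique-in-closedNbhd {v} {x} {y} x∈N[v] y∈N[v] cx cy =
    centre-unique centre-x centre-y level-x≡level-y
    where
    centre-x = proj₁ (colour≡suc⇒centre cx)
    centre-y = proj₁ (colour≡suc⇒centre cy)
    same-mod : level x mod 3 ≡ level y mod 3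
    same-mod = trans (proj₂ (colour≡suc⇒centre cx)) (sym (proj₂ (colour≡suc⇒centre cy)))
    spread : ∀ {w w′} → T (inN[ G ] v w) → T (inN[ G ] v w′) → level w′ < 3 + level w
    spread w∈ w′∈ = s≤s (≤-trans (proj₁ (level-in-closedNbhd w′∈)) (s≤s (proj₂ (level-in-closedNbhd w∈))))
    level-x≡level-y : level x ≡ level y
    level-x≡level-y with ≤-total (level x) (level y)
    ... | inj₁ x≤y = mod-injective-window 3 x≤y (spread x∈N[v] y∈N[v]) same-mod
    ... | inj₂ y≤x = sym (mod-injective-window 3 y≤x (spread y∈N[v] x∈N[v]) (sym same-mod))

  closedNbhd-coloured-≤1 : ∀ v (i : Fin 3) → count (λ w → inN[ G ] v w ∧ ⌊ colour w ≟ suc i ⌋) ≤ 1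
  closedNbhd-coloured-≤1 v i = count-≤1 _ λ x y px py →
    let x∈N[v] , cx = Equivalence.to (T-∧ {inN[ G ] v x}) px
        y∈N[v] , cy = Equivalence.to (T-∧ {inN[ G ] v y}) py
    in colour-unique-in-closedNbhd x∈N[v] y∈N[v] (toWitness cx) (toWitness cy)

  closedNbhd-uncoloured-≤deg : ∀ v → count (λ w → inN[ G ] v w ∧ ⌊ colour w ≟ zero ⌋) ≤ deg G v
  closedNbhd-uncoloured-≤deg v with centre-dominates v
  ... | u , centre-u , u-near = ≤-pred (begin-strict
    count (λ w → inN[ G ] v w ∧ ⌊ colour w ≟ zero ⌋)
      <⟨ count-< _ (inN[ G ] v) (λ w → proj₁ ∘ Equivalence.to (T-∧ {inN[ G ] v w})) u u∈N[v] u-coloured ⟩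
    count (inN[ G ] v)
      ≤⟨ count-insert (inN[ G ] v) (adj G v) v (λ w → Equivalence.to (∈closedNbhd⇔ {G = G} {v} {w})) ⟩
    suc (deg G v) ∎)
    where
    open ≤-Reasoning
    u∈N[v] : T (inN[ G ] v u)
    u∈N[v] = Equivalence.from (∈closedNbhd⇔ {G = G} {v} {u}) u-near
    u-coloured : ¬ T (inN[ G ] v u ∧ ⌊ colour u ≟ zero ⌋)
    u-coloured p = centre⇒colour≢zero centre-u (toWitness (proj₂ (Equivalence.to (T-∧ {inN[ G ] v u}) p)))

  layered⇒subsetSquareColouring : HasSubsetSquareColouring G 3
  layered⇒subsetSquareColouring = colour , closedNbhd-coloured-≤1 , closedNbhd-uncoloured-≤deg

-- Permutation diagrams

record PermutationDiagram (G : Graph n) : Set where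
  field
    top bottom       : Fin n → ℕ
    top-injective    : ∀ {x y} → top x ≡ top y → x ≡ y
    bottom-injective : ∀ {x y} → bottom x ≡ bottom y → x ≡ y
    adj⇔crossing     : ∀ {x y} → top x < top y → T (adj G x y) ⇔ bottom y < bottom x

permutationDiagram : {G : Graph n} → IsPermutationGraph G → PermutationDiagram G
permutationDiagram (σ , π , perm) = record
  { top              = toℕ ∘ Inverse.to σ
  ; bottom           = toℕ ∘ Inverse.to π ∘ Inverse.to σ
  ; top-injective    = σ-injective ∘ toℕ-injective
  ; bottom-injective = σ-injective ∘ Injection.injective (↔⇒↣ π) ∘ toℕ-injective
  ; adj⇔crossing     = λ {x} {y} x<y → mk⇔ (proj₁ (perm x y x<y)) (proj₂ (perm x y x<y))
  }
  where σ-injective = Injection.injective (↔⇒↣ σ)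

module Diagram {G : Graph n} (D : PermutationDiagram G) where
  open PermutationDiagram D public

  adj-irrefl : ∀ {x} → ¬ T (adj G x x)
  adj-irrefl {x} xx = subst T (irrefl G x) xx

  adj⇒crossing : ∀ {x y} → T (adj G x y) →
                 (top x < top y × bottom y < bottom x) ⊎ (top y < top x × bottom x < bottom y)
  adj⇒crossing {x} {y} xy with <-cmp (top x) (top y)
  ... | tri< x<y _ _ = inj₁ (x<y , Equivalence.to (adj⇔crossing x<y) xy)
  ... | tri≈ _ x≡y _ = ⊥-elim (adj-irrefl (subst (T ∘ adj G x) (sym (top-injective x≡y)) xy))
  ... | tri> _ _ y<x = inj₂ (y<x , Equivalence.to (adj⇔crossing y<x) (subst T (symm G x y) xy))

  reach : ℕ → ℕ
  reach α = strictSup (λ x → top x <? α) bottom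

  Farthest : ℕ → Fin n → Set
  Farthest α u = top u < α × suc (bottom u) ≡ reach α

  farthest? : ∀ α → Decidable (Farthest α)
  farthest? α u = top u <? α ×-dec suc (bottom u) ℕ.≟ reach α

  reach-bound : ∀ {α x} → top x < α → bottom x < reach α
  reach-bound = strictSup-bound (λ x → top x <? _) bottom

  farthest-exists : ∀ {α} → 0 < reach α → ∃[ u ] Farthest α u
  farthest-exists = strictSup-attained (λ x → top x <? _) bottom

  farthest-unique : ∀ {α u w} → Farthest α u → Farthest α w → u ≡ w
  farthest-unique (_ , ru) (_ , rw) = bottom-injective (ℕ.suc-injective (trans ru (sym rw)))

  -- The farthest segment starts left of v and ends at or right of v, so it crosses v unless it is v.
  farthest-dominates : ∀ {α v} → α ≤ top v → bottom v < reach α →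
                       ∃[ u ] Farthest α u × bottom v ≤ bottom u × (u ≡ v ⊎ T (adj G v u))
  farthest-dominates {α} {v} α≤v v<reach with farthest-exists (<-≤-trans (s≤s z≤n) v<reach)
  ... | u , (u<α , ru) = u , (u<α , ru) , v≤u , u-near
    where
    v≤u : bottom v ≤ bottom u
    v≤u = ≤-pred (subst (bottom v <_) (sym ru) v<reach)
    u-near : u ≡ v ⊎ T (adj G v u)
    u-near with m≤n⇒m<n∨m≡n v≤u
    ... | inj₂ v≡u = inj₁ (bottom-injective (sym v≡u))
    ... | inj₁ v<u = inj₂ (subst T (symm G u v) (Equivalence.from (adj⇔crossing u<v) v<u))
      where u<v = <-≤-trans u<α α≤v

  flip : PermutationDiagram G
  flip = record
    { top              = bottom
    ; bottom           = top
    ; top-injective    = bottom-injective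
    ; bottom-injective = top-injective
    ; adj⇔crossing     = λ {x} {y} x<y → mk⇔ (to x<y) (from x<y)
    }
    where
    to : ∀ {x y} → bottom x < bottom y → T (adj G x y) → top y < top x
    to x<y xy with adj⇒crossing xy
    ... | inj₁ (_ , y<x) = ⊥-elim (<-asym x<y y<x)
    ... | inj₂ (y<x , _) = y<x
    from : ∀ {x y} → bottom x < bottom y → top y < top x → T (adj G x y)
    from {x} {y} x<y y<x = subst T (symm G y x) (Equivalence.from (adj⇔crossing y<x) x<y)

-- The sweep of a connected permutation diagram

module Sweep {G : Graph n} (D : PermutationDiagram G) (connected : Connected G)
             (origin : Fin n) (top-origin : PermutationDiagram.top D origin ≡ 0) where
  open Diagram D
  open Diagram flip using ()
    renaming ( reach to topReach; Farthest to TopFarthest; farthest? to topFarthest?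
             ; reach-bound to topReach-bound; farthest-exists to topFarthest-exists
             ; farthest-unique to topFarthest-unique; farthest-dominates to topFarthest-dominates )

  A C : ℕ → ℕ
  A zero    = 1
  A (suc k) = A k ⊔ topReach (C k)
  C zero    = 0
  C (suc k) = C k ⊔ reach (A k)

  data Swept (k : ℕ) (x : Fin n) : Set where
    top-swept    : top x < A k → Swept k x
    bottom-swept : bottom x < C k → Swept k x

  swept? : ∀ x k → Dec (Swept k x)
  swept? x k = map′ [ top-swept , bottom-swept ]′ as-sum (top x <? A k ⊎-dec bottom x <? C k)
    where
    as-sum : Swept k x → top x < A k ⊎ bottom x < C k
    as-sum (top-swept x<A)    = inj₁ x<A
    as-sum (bottom-swept x<C) = inj₂ x<C

  A≤A-suc : ∀ k → A k ≤ A (suc k)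
  A≤A-suc k = m≤m⊔n (A k) (topReach (C k))

  topReach≤A-suc : ∀ k → topReach (C k) ≤ A (suc k)
  topReach≤A-suc k = m≤n⊔m (A k) (topReach (C k))

  C≤C-suc : ∀ k → C k ≤ C (suc k)
  C≤C-suc k = m≤m⊔n (C k) (reach (A k))

  reach≤C-suc : ∀ k → reach (A k) ≤ C (suc k)
  reach≤C-suc k = m≤n⊔m (C k) (reach (A k))

  A-mono : ∀ {j k} → j ≤ k → A j ≤ A k
  A-mono = monotone-by-steps A A≤A-suc

  C-mono : ∀ {j k} → j ≤ k → C j ≤ C k
  C-mono = monotone-by-steps C C≤C-suc

  swept-step : ∀ {k x y} → Swept k x → T (adj G x y) → Swept (suc k) y
  swept-step {k} x-swept xy with x-swept | adj⇒crossing xy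
  ... | top-swept x<A    | inj₂ (y<x , _) = top-swept    (<-≤-trans (<-trans y<x x<A) (A≤A-suc k))
  ... | top-swept x<A    | inj₁ (_ , y<x) = bottom-swept (<-≤-trans (<-trans y<x (reach-bound x<A)) (reach≤C-suc k))
  ... | bottom-swept x<C | inj₁ (_ , y<x) = bottom-swept (<-≤-trans (<-trans y<x x<C) (C≤C-suc k))
  ... | bottom-swept x<C | inj₂ (y<x , _) = top-swept    (<-≤-trans (<-trans y<x (topReach-bound x<C)) (topReach≤A-suc k))

  swept-along-walk : ∀ {k u w} → Swept k u → Walk G u w → ∃[ m ] Swept m w
  swept-along-walk u-swept here       = _ , u-swept
  swept-along-walk u-swept (step e p) = swept-along-walk (swept-step u-swept e) p

  top-origin<1 : top origin < 1
  top-origin<1 = subst (_< 1) (sym top-origin) (s≤s z≤n)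

  origin-swept : Swept 0 origin
  origin-swept = top-swept top-origin<1

  swept₀⇒origin : ∀ {x} → Swept 0 x → x ≡ origin
  swept₀⇒origin (top-swept x<1) = top-injective (trans (n<1⇒n≡0 x<1) (sym top-origin))

  level-witness : ∀ x → Least (λ k → Swept k x)
  level-witness x = least-witness (swept? x) (proj₂ (swept-along-walk origin-swept (connected origin x)))

  level : Fin n → ℕ
  level x = proj₁ (level-witness x)

  level-swept : ∀ x → Swept (level x) x
  level-swept x = proj₁ (proj₂ (level-witness x))

  level-minimal : ∀ x {j} → j < level x → ¬ Swept j x
  level-minimal x = proj₂ (proj₂ (level-witness x))

  level-exact : ∀ {k x} → Swept k x → (∀ {j} → j < k → ¬ Swept j x) → level x ≡ k
  level-exact {k} {x} x-swept earlier = ≤-antisym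
    (≮⇒≥ λ k<level → level-minimal x k<level x-swept)
    (≮⇒≥ λ level<k → earlier level<k (level-swept x))

  level-lipschitz : ∀ {x y} → T (adj G x y) → level y ≤ suc (level x)
  level-lipschitz {x} {y} xy = ≮⇒≥ λ 1+x<y → level-minimal y 1+x<y (swept-step (level-swept x) xy)

  unswept-if-bottom-beyond : ∀ {j k x} → j < k → C k ≤ bottom x → ¬ Swept j x
  unswept-if-bottom-beyond {j} {k} j<k Ck≤x (top-swept x<A) =
    <⇒≱ (reach-bound x<A) (≤-trans (reach≤C-suc j) (≤-trans (C-mono j<k) Ck≤x))
  unswept-if-bottom-beyond j<k Ck≤x (bottom-swept x<C) = <⇒≱ x<C (≤-trans (C-mono (<⇒≤ j<k)) Ck≤x)

  unswept-if-top-beyond : ∀ {j k x} → j < k → A k ≤ top x → ¬ Swept j x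
  unswept-if-top-beyond {j} {k} j<k Ak≤x (bottom-swept x<C) =
    <⇒≱ (topReach-bound x<C) (≤-trans (topReach≤A-suc j) (≤-trans (A-mono j<k) Ak≤x))
  unswept-if-top-beyond j<k Ak≤x (top-swept x<A) = <⇒≱ x<A (≤-trans (A-mono (<⇒≤ j<k)) Ak≤x)

  topReach-zero : topReach 0 ≡ 0
  topReach-zero = n≤0⇒n≡0 (≮⇒≥ λ pos → n≮0 (proj₁ (proj₂ (topFarthest-exists pos))))

  A-fixed₀ : A 1 ≡ A 0
  A-fixed₀ = cong (1 ⊔_) topReach-zero

  -- C (suc k) already covers reach (A k), so once A stops moving C stops at the next stage, and vice versa.
  one-side-grows : ∀ k → A (suc k) ≡ A k ⊎ C (suc k) ≡ C k
  one-side-grows zero = inj₁ A-fixed₀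
  one-side-grows (suc k) with one-side-grows k
  ... | inj₁ A-fixed rewrite A-fixed = inj₂ (m≥n⇒m⊔n≡m (reach≤C-suc k))
  ... | inj₂ C-fixed rewrite C-fixed = inj₁ (m≥n⇒m⊔n≡m (topReach≤A-suc k))

  data CentreAt (k : ℕ) (u : Fin n) : Set where
    bottom-centre : A (suc k) ≡ A k → Farthest (A k) u → CentreAt k u
    top-centre    : A (suc k) ≢ A k → TopFarthest (C k) u → CentreAt k u

  centreAt? : ∀ k → Decidable (CentreAt k)
  centreAt? k u with A (suc k) ℕ.≟ A k
  ... | yes fixed = map′ (bottom-centre fixed) farthest (farthest? (A k) u)
    where
    farthest : CentreAt k u → Farthest (A k) u
    farthest (bottom-centre _ far) = far
    farthest (top-centre moves _)  = ⊥-elim (moves fixed)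
  ... | no moves = map′ (top-centre moves) farthest (topFarthest? (C k) u)
    where
    farthest : CentreAt k u → TopFarthest (C k) u
    farthest (top-centre _ far)     = far
    farthest (bottom-centre fixed _) = ⊥-elim (moves fixed)

  centreAt-unique : ∀ {k x y} → CentreAt k x → CentreAt k y → x ≡ y
  centreAt-unique (bottom-centre _ fx)     (bottom-centre _ fy)   = farthest-unique fx fy
  centreAt-unique (top-centre _ fx)        (top-centre _ fy)      = topFarthest-unique fx fy
  centreAt-unique (bottom-centre fixed _)  (top-centre moves _)   = ⊥-elim (moves fixed)
  centreAt-unique (top-centre moves _)     (bottom-centre fixed _) = ⊥-elim (moves fixed)

  origin-centre : CentreAt 0 origin
  origin-centre with farthest-exists {1} (<-≤-trans (s≤s z≤n) (reach-bound top-origin<1))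
  ... | u , far@(u<1 , _) = subst (CentreAt 0) (swept₀⇒origin (top-swept u<1)) (bottom-centre A-fixed₀ far)

  newly-swept : ∀ {k v} → level v ≡ suc k → ¬ Swept k v × Swept (suc k) v
  newly-swept {k} {v} eq =
    level-minimal v (subst (k <_) (sym eq) ≤-refl) , subst (λ j → Swept j v) eq (level-swept v)

  entered-below-reach : ∀ {k v} → A (suc k) ≡ A k → ¬ Swept k v → Swept (suc k) v →
                        bottom v < reach (A k)
  entered-below-reach {v = v} A-fixed old (top-swept v<A′) =
    ⊥-elim (old (top-swept (subst (top v <_) A-fixed v<A′)))
  entered-below-reach {k} A-fixed old (bottom-swept v<C′) with m<n⊔o⇒m<n⊎m<o (C k) (reach (A k)) v<C′
  ... | inj₁ v<C = ⊥-elim (old (bottom-swept v<C))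
  ... | inj₂ v<r = v<r

  entered-below-topReach : ∀ {k v} → C (suc k) ≡ C k → ¬ Swept k v → Swept (suc k) v →
                           top v < topReach (C k)
  entered-below-topReach {v = v} C-fixed old (bottom-swept v<C′) =
    ⊥-elim (old (bottom-swept (subst (bottom v <_) C-fixed v<C′)))
  entered-below-topReach {k} C-fixed old (top-swept v<A′) with m<n⊔o⇒m<n⊎m<o (A k) (topReach (C k)) v<A′
  ... | inj₁ v<A = ⊥-elim (old (top-swept v<A))
  ... | inj₂ v<r = v<r

  dominated-when-A-fixed : ∀ {k v} → A (suc k) ≡ A k → ¬ Swept k v → Swept (suc k) v →
                           ∃[ u ] Farthest (A k) u × level u ≡ k × (u ≡ v ⊎ T (adj G v u))
  dominated-when-A-fixed {k} A-fixed old new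
    with farthest-dominates (≮⇒≥ (old ∘ top-swept)) (entered-below-reach A-fixed old new)
  ... | u , far@(u<A , _) , v≤u , u-near = u , far , level-exact (top-swept u<A) earlier , u-near
    where
    earlier : ∀ {j} → j < k → ¬ Swept j u
    earlier j<k = unswept-if-bottom-beyond j<k (≤-trans (≮⇒≥ (old ∘ bottom-swept)) v≤u)

  dominated-when-C-fixed : ∀ {k v} → C (suc k) ≡ C k → ¬ Swept k v → Swept (suc k) v →
                           ∃[ u ] TopFarthest (C k) u × level u ≡ k × (u ≡ v ⊎ T (adj G v u))
  dominated-when-C-fixed {k} C-fixed old new
    with topFarthest-dominates (≮⇒≥ (old ∘ bottom-swept)) (entered-below-topReach C-fixed old new)
  ... | u , far@(u<C , _) , v≤u , u-near = u , far , level-exact (bottom-swept u<C) earlier , u-near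
    where
    earlier : ∀ {j} → j < k → ¬ Swept j u
    earlier j<k = unswept-if-top-beyond j<k (≤-trans (≮⇒≥ (old ∘ top-swept)) v≤u)

  newcomer-dominated : ∀ {k v} → ¬ Swept k v → Swept (suc k) v →
                       ∃[ u ] CentreAt k u × level u ≡ k × (u ≡ v ⊎ T (adj G v u))
  newcomer-dominated {k} old new with A (suc k) ℕ.≟ A k | one-side-grows k
  ... | yes A-fixed | _ with dominated-when-A-fixed A-fixed old new
  ...   | u , far , u-level , u-near = u , bottom-centre A-fixed far , u-level , u-near
  newcomer-dominated old new | no A-moves | inj₁ A-fixed = ⊥-elim (A-moves A-fixed)
  newcomer-dominated old new | no A-moves | inj₂ C-fixed with dominated-when-C-fixed C-fixed old new
  ...   | u , far , u-level , u-near = u , top-centre A-moves far , u-level , u-near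

  centre-dominates : ∀ v → ∃[ u ] CentreAt (level u) u × (u ≡ v ⊎ T (adj G v u))
  centre-dominates v with level v in eq
  ... | zero = origin , subst (λ j → CentreAt j origin) (sym origin-level) origin-centre , inj₁ (sym v≡origin)
    where
    v≡origin = swept₀⇒origin (subst (λ j → Swept j v) eq (level-swept v))
    origin-level = level-exact origin-swept (λ ())
  ... | suc k with newly-swept eq
  ...   | old , new with newcomer-dominated old new
  ...     | u , centre , refl , u-near = u , centre , u-near

  layeredDominatingSet : LayeredDominatingSet G
  layeredDominatingSet = record
    { level            = level
    ; Centre           = λ x → CentreAt (level x) x
    ; centre?          = λ x → centreAt? (level x) x
    ; level-lipschitz  = level-lipschitz
    ; centre-unique    = λ {x} {y} cx cy same →
                           centreAt-unique cx (subst (λ j → CentreAt j y) (sym same) cy)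
    ; centre-dominates = centre-dominates
    }

connectedPermutationGraph⇒colouring : (G : Graph n) → Connected G → IsPermutationGraph G →
                                      HasSubsetSquareColouring G 3
connectedPermutationGraph⇒colouring {zero}  G connected perm = (λ ()) , (λ ()) , (λ ())
connectedPermutationGraph⇒colouring {suc _} G connected perm@(σ , _) =
  layered⇒subsetSquareColouring
    (Sweep.layeredDominatingSet (permutationDiagram perm) connected leftmost top-leftmost)
  where
  leftmost = Inverse.from σ zero
  top-leftmost = cong toℕ (Inverse.strictlyInverseˡ σ zero)

mainTheorem18 : ∀ {n : ℕ} (G : Graph n) → Connected G → BipartitePermutationGraph G → χssc≤ G 4
mainTheorem18 G connected (_ , perm) =
  3 , s≤s z≤n , s≤s (s≤s (s≤s z≤n)) , connectedPermutationGraph⇒colouring G connected perm
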